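{- Let $G$ be an internally-triangulated primary $st$-outerpath and let $F_1,\dots,F_k$ be an $st$-fan decomposition of $G$, with $F_i$ an $s_it_i$-fan and $e_i$ the edge shared by $F_i$ and $F_{i+1}$. For any $i$, if $F_{i+1}$ is not one-sided, then $e_i=s_{i+1}t_i$.
   Context: An $st$-DAG is a DAG with exactly one source $s$ and one sink $t$. An $st$-outerpath is an $st$-DAG whose underlying graph is an outerpath (outerplanar with weak dual $\overline{G}$ — one node per inner face, adjacent when faces share an edge — a path); internally triangulated means biconnected with all inner faces triangles. The extreme faces are those at the endpoints of $\overline{G}$; $G$ is primary if one extreme face is incident to $s$. Order the faces $\langle f_1,\dots,f_h\rangle$ along $\overline{G}$. An $xy$-fan is an $xy$-DAG whose underlying graph is an internally-triangulated outerpath all of whose inner edges are incident to $x$; it is one-sided if $xy$ is an edge on its outer face. A subgraph $F$ formed by consecutive faces $f_j,\dots,f_i$ that is an $xy$-fan is incrementally maximal if $i=h$ or $F\cup f_{i+1}$ is not an $xy$-fan. An $st$-fan decomposition of $G$ is a sequence $F_1,\dots,F_k$ of such subgraphs, $F_i$ an $s_it_i$-fan, with: (i) each $F_i$ incrementally maximal; (ii) for $j>i+1$, $F_i,F_j$ share no edge, while $F_i,F_{i+1}$ share exactly one edge $e_i$; (iii) $s_1=s$; (iv) the tail of $e_i$ is $s_{i+1}$; (v) $e_i\neq s_it_i$; (vi) $\bigcup_i F_i=G$. -}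

module Defs where

open import Data.Nat using (ℕ; zero; suc; _≤_; _<_; _∸_)
open import Data.Product using (Σ; ∃; _×_; _,_)
open import Data.Sum using (_⊎_)
open import Data.Empty using (⊥)
open import Relation.Nullary using (¬_)
open import Relation.Binary.PropositionalEquality using (_≡_; _≢_)
open import Relation.Binary.Construct.Closure.Transitive using (TransClosure)

-- Vertices are natural numbers.  A (graph on ℕ) is given by its edge
-- relation; a directed graph by its arc relation.

Rel : Set₁
Rel = ℕ → ℕ → Set

SameEdge : ℕ → ℕ → ℕ → ℕ → Set
SameEdge a b c d = (a ≡ c × b ≡ d) ⊎ (a ≡ d × b ≡ c)

record Tri : Set where
  constructor tri
  field
    a b c : ℕ

_∈T_ : ℕ → Tri → Set
v ∈T tri a b c = v ≡ a ⊎ v ≡ b ⊎ v ≡ c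

EdgeT : Tri → Rel
EdgeT t u v = u ∈T t × v ∈T t × u ≢ v

-- Internally-triangulated outerpath, given by its sequence of inner
-- faces f_0, …, f_{h-1} in the order of the weak dual path.
-- (A triangle strip: each new face shares an edge with the previous
-- one and introduces a new vertex; faces at distance 2 share no edge.)

record Outerpath : Set where
  field
    h        : ℕ
    h≥1      : 1 ≤ h
    face     : ℕ → Tri
    distinct : ∀ i → i < h → let open Tri (face i) in a ≢ b × b ≢ c × a ≢ c
    adjacent : ∀ i → suc i < h →
               ∃ λ u → ∃ λ v → EdgeT (face i) u v × EdgeT (face (suc i)) u v
    newVert  : ∀ i → suc i < h →
               ∃ λ w → w ∈T face (suc i) × (∀ j → j ≤ i → ¬ (w ∈T face j))
    apart    : ∀ i → suc (suc i) < h → ∀ u v →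
               EdgeT (face i) u v → ¬ EdgeT (face (suc (suc i))) u v

open Outerpath public

GEdge : Outerpath → Rel
GEdge G u v = ∃ λ i → i < h G × EdgeT (face G i) u v

RangeEdge : Outerpath → ℕ → ℕ → Rel
RangeEdge G lo hi u v = ∃ λ i → lo ≤ i × i ≤ hi × EdgeT (face G i) u v

RangeInner : Outerpath → ℕ → ℕ → Rel
RangeInner G lo hi u v =
  ∃ λ i → ∃ λ j → lo ≤ i × i < j × j ≤ hi ×
    EdgeT (face G i) u v × EdgeT (face G j) u v

Vert : Rel → ℕ → Set
Vert E v = ∃ λ u → E v u

record IsDAG (E A : Rel) (x y : ℕ) : Set where
  field
    orient   : ∀ u v → E u v → A u v ⊎ A v u
    arcEdge  : ∀ u v → A u v → E u v
    acyclic  : ∀ v → ¬ TransClosure A v v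
    x-vert   : Vert E x
    x-source : ∀ u → ¬ A u x
    x-unique : ∀ v → Vert E v → (∀ u → ¬ A u v) → v ≡ x
    y-vert   : Vert E y
    y-sink   : ∀ u → ¬ A y u
    y-unique : ∀ v → Vert E v → (∀ u → ¬ A v u) → v ≡ y

Restrict : Rel → Rel → Rel
Restrict A E u v = A u v × E u v

IsFan : Outerpath → Rel → ℕ → ℕ → ℕ → ℕ → Set
IsFan G A lo hi x y =
  lo ≤ hi × hi < h G ×
  IsDAG (RangeEdge G lo hi) (Restrict A (RangeEdge G lo hi)) x y ×
  (∀ u v → RangeInner G lo hi u v → u ≡ x ⊎ v ≡ x)

-- One-sided: xy is an edge on the outer face of the fan
OneSided : Outerpath → ℕ → ℕ → ℕ → ℕ → Set
OneSided G lo hi x y = RangeEdge G lo hi x y × ¬ RangeInner G lo hi x y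

IncMax : Outerpath → Rel → ℕ → ℕ → ℕ → ℕ → Set
IncMax G A lo hi x y = suc hi ≡ h G ⊎ ¬ IsFan G A lo (suc hi) x y

-- st-fan decomposition F_0, …, F_{k-1}; F_m consists of faces
-- f_{lo m} … f_{hi m} and is an (src m)(snk m)-fan; e_m is the edge
-- shared by F_m and F_{m+1}, with tail eTl m and head eHd m.

record FanDecomp (G : Outerpath) (A : Rel) (s : ℕ) : Set where
  field
    k     : ℕ
    k≥1   : 1 ≤ k
    lo hi src snk eTl eHd : ℕ → ℕ
    fan     : ∀ m → m < k → IsFan G A (lo m) (hi m) (src m) (snk m)
    incMax  : ∀ m → m < k → IncMax G A (lo m) (hi m) (src m) (snk m)
    disjoint : ∀ m m' → suc m < m' → m' < k → ∀ u v →
               RangeEdge G (lo m) (hi m) u v → ¬ RangeEdge G (lo m') (hi m') u v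
    e-arc   : ∀ m → suc m < k → A (eTl m) (eHd m)
    e-in    : ∀ m → suc m < k →
              RangeEdge G (lo m) (hi m) (eTl m) (eHd m) ×
              RangeEdge G (lo (suc m)) (hi (suc m)) (eTl m) (eHd m)
    e-only  : ∀ m → suc m < k → ∀ u v →
              RangeEdge G (lo m) (hi m) u v →
              RangeEdge G (lo (suc m)) (hi (suc m)) u v →
              SameEdge u v (eTl m) (eHd m)
    src-first : src 0 ≡ s
    e-tail  : ∀ m → suc m < k → eTl m ≡ src (suc m)
    e-not   : ∀ m → suc m < k → ¬ SameEdge (eTl m) (eHd m) (src m) (snk m)
    cover   : ∀ u v → GEdge G u v →
              ∃ λ m → m < k × RangeEdge G (lo m) (hi m) u v

IsSTOuterpath : Outerpath → Rel → ℕ → ℕ → Set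
IsSTOuterpath G A s t = IsDAG (GEdge G) A s t

Primary : Outerpath → ℕ → Set
Primary G s = s ∈T face G 0 ⊎ s ∈T face G (h G ∸ 1)

module Submission where

-- Write e_i = pw, so p = s_{i+1}, and suppose w ≠ t_i.  Then p and w both reach t_i inside F_i,
-- and, since F_{i+1} is not one-sided, both reach t_{i+1} inside F_{i+1}.  Two consecutive fans
-- occupy disjoint runs of faces and share only pw, so pw lies on two adjacent faces of the strip
-- and cuts G into two sides that meet only in p and w, with t_i and t_{i+1} on opposite sides.
-- A directed path from t_i to the sink t cannot pass through p or w, as that would close a cycle
-- through t_i; so t lies on the side of t_i, and likewise on the side of t_{i+1}.  Hence t is p
-- or w, and t reaches t_i, which reaches t: a cycle.

open import Defs
open import Data.Nat using (ℕ; zero; suc; _<_; _≤_; _≟_; _<?_; _≤?_; z≤n; s≤s)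
open import Data.Nat.Properties
open import Data.Product using (Σ; ∃; _×_; _,_; proj₁; proj₂)
open import Data.Sum using (_⊎_; inj₁; inj₂)
open import Data.Empty using (⊥; ⊥-elim)
open import Data.List using (List; []; _∷_; _++_; length; lookup)
open import Data.List.Membership.Propositional using (_∈_; lose)
open import Data.List.Membership.Propositional.Properties using (∈-++⁺ˡ; ∈-++⁺ʳ)
open import Data.List.Relation.Unary.Any using (here; there; index; satisfied; any?)
open import Data.List.Relation.Unary.Any.Properties using (lookup-index)
open import Data.Fin using (Fin; toℕ)
import Data.Fin.Properties as Fin
open import Function using (_∘_)
open import Relation.Nullary using (¬_; Dec; yes; no)
open import Relation.Nullary.Decidable using (_⊎-dec_; _×-dec_; ¬?)
open import Relation.Binary.PropositionalEquality using (_≡_; _≢_; refl; sym; trans; subst; cong)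
open import Relation.Binary.Construct.Closure.Transitive using (TransClosure; [_]; _∷_; _∷ʳ_)
  renaming (_++_ to _▸_)

Path : Rel → Rel
Path = TransClosure

Reaches : Rel → Rel
Reaches R u v = u ≡ v ⊎ Path R u v

Sink : Rel → ℕ → Set
Sink R z = ∀ u → ¬ R z u

Path-last : ∀ {R u v} → Path R u v → ∃ λ w → R w v
Path-last [ r ] = _ , r
Path-last (_ ∷ p) = Path-last p

Path-restrict : ∀ {A E u v} → Path (Restrict A E) u v → Path A u v
Path-restrict [ r ] = [ proj₁ r ]
Path-restrict (r ∷ p) = proj₁ r ∷ Path-restrict p

module _ {R : Rel} (R? : ∀ u v → Dec (R u v))
         (Vs : List ℕ) (target∈ : ∀ {u v} → R u v → v ∈ Vs)
         (acyclic : ∀ v → ¬ Path R v v) where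

  Walk : ℕ → ℕ → Set
  Walk n v = Σ (ℕ → ℕ) λ f → f 0 ≡ v × (∀ k → k < n → R (f k) (f (suc k)))

  ReachesSink : ℕ → Set
  ReachesSink v = ∃ λ z → Reaches R v z × Sink R z

  successor-or-sink : ∀ v → (∃ λ u → R v u) ⊎ Sink R v
  successor-or-sink v with any? (R? v) Vs
  ... | yes r = inj₁ (satisfied r)
  ... | no ¬r = inj₂ λ u r → ¬r (lose (target∈ r) r)

  reachesSink-or-walk : ∀ n v → ReachesSink v ⊎ Walk n v
  reachesSink-or-walk zero v = inj₂ ((λ _ → v) , refl , λ _ ())
  reachesSink-or-walk (suc n) v with successor-or-sink v
  ... | inj₂ v-sink = inj₁ (v , inj₁ refl , v-sink)
  ... | inj₁ (u , r) with reachesSink-or-walk n u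
  ...   | inj₁ (z , inj₁ refl , z-sink) = inj₁ (z , inj₂ [ r ] , z-sink)
  ...   | inj₁ (z , inj₂ u⇝z , z-sink) = inj₁ (z , inj₂ (r ∷ u⇝z) , z-sink)
  ...   | inj₂ (f , refl , steps) = inj₂ (g , refl , steps′)
    where
      g : ℕ → ℕ
      g zero = v
      g (suc k) = f k
      steps′ : ∀ k → k < suc n → R (g k) (g (suc k))
      steps′ zero _ = r
      steps′ (suc k) (s≤s k<n) = steps k k<n

  walk-path : ∀ {n} (f : ℕ → ℕ) → (∀ k → k < n → R (f k) (f (suc k))) →
              ∀ a b → a < b → b ≤ n → Path R (f a) (f b)
  walk-path f steps a (suc b) a<1+b 1+b≤n with m≤n⇒m<n∨m≡n (≤-pred a<1+b)
  ... | inj₁ a<b = walk-path f steps a b a<b (≤-trans (n≤1+n b) 1+b≤n) ∷ʳ steps b 1+b≤n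
  ... | inj₂ refl = [ steps a 1+b≤n ]

  -- By pigeonhole, a walk with more steps than there are vertices revisits one of them.
  ¬long-walk : ∀ {v} → ¬ Walk (suc (length Vs)) v
  ¬long-walk (f , _ , steps) = acyclic _ (subst (Path R (f (suc (toℕ i)))) (sym same) cycle)
    where
      visited : (k : Fin (suc (length Vs))) → f (suc (toℕ k)) ∈ Vs
      visited k = target∈ (steps (toℕ k) (Fin.toℕ<n k))
      collision = Fin.pigeonhole (n<1+n (length Vs)) (index ∘ visited)
      i = proj₁ collision
      j = proj₁ (proj₂ collision)
      same : f (suc (toℕ i)) ≡ f (suc (toℕ j))
      same = trans (lookup-index (visited i))
                   (trans (cong (lookup Vs) (proj₂ (proj₂ (proj₂ collision))))
                          (sym (lookup-index (visited j))))
      cycle : Path R (f (suc (toℕ i))) (f (suc (toℕ j)))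
      cycle = walk-path f steps _ _ (s≤s (proj₁ (proj₂ (proj₂ collision)))) (Fin.toℕ<n j)

  reachesSink : ∀ v → ReachesSink v
  reachesSink v with reachesSink-or-walk (suc (length Vs)) v
  ... | inj₁ found = found
  ... | inj₂ walk = ⊥-elim (¬long-walk walk)

record FiniteGraph (E : Rel) : Set where
  field
    vertices  : List ℕ
    ∈vertices : ∀ {u v} → E u v → v ∈ vertices
    adjacent? : ∀ u v → Dec (E u v)
    symmetric : ∀ {u v} → E u v → E v u

module _ {E R : Rel} {x y : ℕ} (finite : FiniteGraph E) (D : IsDAG E R x y) where
  open FiniteGraph finite
  open IsDAG D

  arc? : ∀ u v → Dec (R u v)
  arc? u v with adjacent? u v
  ... | no ¬e = no (¬e ∘ arcEdge u v)
  ... | yes e with orient u v e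
  ...   | inj₁ r = yes r
  ...   | inj₂ r = no λ r′ → acyclic u (r′ ∷ [ r ])

  reaches-sink : ∀ v → Vert E v → Reaches R v y
  reaches-sink v v∈E
    with reachesSink arc? vertices (λ r → ∈vertices (arcEdge _ _ r)) acyclic v
  ... | z , inj₁ refl , z-sink = inj₁ (y-unique v v∈E z-sink)
  ... | z , inj₂ v⇝z , z-sink = inj₂ (subst (Path R v) (y-unique z z∈E z-sink) v⇝z)
    where
      z∈E : Vert E z
      z∈E = proj₁ (Path-last v⇝z) , symmetric (arcEdge _ z (proj₂ (Path-last v⇝z)))

  arc-ends-reach-sink : ∀ {p w} → R p w → w ≢ y → ∀ b → b ≡ p ⊎ b ≡ w → Path R b y
  arc-ends-reach-sink {p} {w} r w≢y b (inj₁ refl) with reaches-sink p (w , arcEdge p w r)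
  ... | inj₁ refl = ⊥-elim (y-sink w r)
  ... | inj₂ p⇝y = p⇝y
  arc-ends-reach-sink {p} {w} r w≢y b (inj₂ refl)
    with reaches-sink w (p , symmetric (arcEdge p w r))
  ... | inj₁ w≡y = ⊥-elim (w≢y w≡y)
  ... | inj₂ w⇝y = w⇝y

ClosedOutside : Rel → (ℕ → Set) → (ℕ → Set) → Set
ClosedOutside E B S = ∀ {u v} → S u → ¬ B u → E u v → S v

record Separation (E : Rel) (B S₀ S₁ : ℕ → Set) : Set where
  field
    closed₀ : ClosedOutside E B S₀
    closed₁ : ClosedOutside E B S₁
    meet    : ∀ {z} → S₀ z → S₁ z → B z

module _ {E A : Rel} {s t : ℕ} (D : IsDAG E A s t)
         (toSink : ∀ v → Vert E v → Reaches A v t) {B : ℕ → Set} (B? : ∀ z → Dec (B z)) where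
  open IsDAG D

  path-leaves-side-through-cut : ∀ {S u z} → ClosedOutside E B S → Path A u z → S u → ¬ B u →
                                 (∃ λ m → B m × Path A u m) ⊎ S z
  path-leaves-side-through-cut {u = u} closed [ r ] su u∉B =
    inj₂ (closed su u∉B (arcEdge u _ r))
  path-leaves-side-through-cut {u = u} closed (_∷_ {y = v} r v⇝z) su u∉B with B? v
  ... | yes v∈B = inj₁ (v , v∈B , [ r ])
  ... | no v∉B
    with path-leaves-side-through-cut closed v⇝z (closed su u∉B (arcEdge u v r)) v∉B
  ...   | inj₁ (m , m∈B , v⇝m) = inj₁ (m , m∈B , r ∷ v⇝m)
  ...   | inj₂ sz = inj₂ sz

  sink-on-side : ∀ {S y} → ClosedOutside E B S → S y → Vert E y →
                 (∀ b → B b → Path A b y) → S t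
  sink-on-side {y = y} closed sy y∈E cut⇝y with toSink y y∈E
  ... | inj₁ refl = sy
  ... | inj₂ y⇝t
    with path-leaves-side-through-cut closed y⇝t sy (λ y∈B → acyclic y (cut⇝y y y∈B))
  ...   | inj₁ (m , m∈B , y⇝m) = ⊥-elim (acyclic y (y⇝m ▸ cut⇝y m m∈B))
  ...   | inj₂ st = st

  ¬cut-reaches-both-sides : ∀ {S₀ S₁ y₀ y₁} → Separation E B S₀ S₁ →
    S₀ y₀ → S₁ y₁ → Vert E y₀ → Vert E y₁ →
    (∀ b → B b → Path A b y₀) → (∀ b → B b → Path A b y₁) → ⊥
  ¬cut-reaches-both-sides {y₀ = y₀} sep s₀ s₁ y₀∈E y₁∈E cut⇝y₀ cut⇝y₁ =
    y₀↛t (toSink y₀ y₀∈E)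
    where
      open Separation sep
      t∈B : B t
      t∈B = meet (sink-on-side closed₀ s₀ y₀∈E cut⇝y₀) (sink-on-side closed₁ s₁ y₁∈E cut⇝y₁)
      y₀↛t : ¬ Reaches A y₀ t
      y₀↛t (inj₁ refl) = acyclic y₀ (cut⇝y₀ y₀ t∈B)
      y₀↛t (inj₂ y₀⇝t) = acyclic y₀ (y₀⇝t ▸ cut⇝y₀ t t∈B)

_∈T?_ : ∀ v t → Dec (v ∈T t)
v ∈T? tri a b c = (v ≟ a) ⊎-dec (v ≟ b) ⊎-dec (v ≟ c)

EdgeT? : ∀ t u v → Dec (EdgeT t u v)
EdgeT? t u v = (u ∈T? t) ×-dec (v ∈T? t) ×-dec ¬? (u ≟ v)

SameEdge-cancelˡ : ∀ {a b c p w} → SameEdge a b p w → SameEdge a c p w → b ≡ c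
SameEdge-cancelˡ (inj₁ (_ , refl)) (inj₁ (_ , refl)) = refl
SameEdge-cancelˡ (inj₁ (refl , refl)) (inj₂ (a≡w , refl)) = sym a≡w
SameEdge-cancelˡ (inj₂ (a≡w , refl)) (inj₁ (refl , refl)) = a≡w
SameEdge-cancelˡ (inj₂ (_ , refl)) (inj₂ (_ , refl)) = refl

private
  ¬3-distinct-∈pair : ∀ {a b x y z : ℕ} → x ≡ a ⊎ x ≡ b → y ≡ a ⊎ y ≡ b → z ≡ a ⊎ z ≡ b →
                      x ≢ y → x ≢ z → y ≢ z → ⊥
  ¬3-distinct-∈pair (inj₁ refl) (inj₁ refl) _ x≢y _ _ = x≢y refl
  ¬3-distinct-∈pair (inj₂ refl) (inj₂ refl) _ x≢y _ _ = x≢y refl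
  ¬3-distinct-∈pair (inj₁ refl) (inj₂ refl) (inj₁ refl) _ x≢z _ = x≢z refl
  ¬3-distinct-∈pair (inj₁ refl) (inj₂ refl) (inj₂ refl) _ _ y≢z = y≢z refl
  ¬3-distinct-∈pair (inj₂ refl) (inj₁ refl) (inj₁ refl) _ _ y≢z = y≢z refl
  ¬3-distinct-∈pair (inj₂ refl) (inj₁ refl) (inj₂ refl) _ x≢z _ = x≢z refl

  ∈T-without-a : ∀ {a b c v} → v ∈T tri a b c → a ≢ v → v ≡ b ⊎ v ≡ c
  ∈T-without-a (inj₁ refl) a≢v = ⊥-elim (a≢v refl)
  ∈T-without-a (inj₂ v∈bc) _ = v∈bc

  ∈T-without-b : ∀ {a b c v} → v ∈T tri a b c → b ≢ v → v ≡ a ⊎ v ≡ c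
  ∈T-without-b (inj₁ v≡a) _ = inj₁ v≡a
  ∈T-without-b (inj₂ (inj₁ refl)) b≢v = ⊥-elim (b≢v refl)
  ∈T-without-b (inj₂ (inj₂ v≡c)) _ = inj₂ v≡c

  ∈T-without-c : ∀ {a b c v} → v ∈T tri a b c → c ≢ v → v ≡ a ⊎ v ≡ b
  ∈T-without-c (inj₁ v≡a) _ = inj₁ v≡a
  ∈T-without-c (inj₂ (inj₁ v≡b)) _ = inj₂ v≡b
  ∈T-without-c (inj₂ (inj₂ refl)) c≢v = ⊥-elim (c≢v refl)

¬4-distinct-∈T : ∀ {t u p r n} → u ∈T t → p ∈T t → r ∈T t → n ∈T t →
                 u ≢ p → u ≢ r → u ≢ n → p ≢ r → p ≢ n → r ≢ n → ⊥
¬4-distinct-∈T {tri _ _ _} (inj₁ refl) p r n u≢p u≢r u≢n =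
  ¬3-distinct-∈pair (∈T-without-a p u≢p) (∈T-without-a r u≢r) (∈T-without-a n u≢n)
¬4-distinct-∈T {tri _ _ _} (inj₂ (inj₁ refl)) p r n u≢p u≢r u≢n =
  ¬3-distinct-∈pair (∈T-without-b p u≢p) (∈T-without-b r u≢r) (∈T-without-b n u≢n)
¬4-distinct-∈T {tri _ _ _} (inj₂ (inj₂ refl)) p r n u≢p u≢r u≢n =
  ¬3-distinct-∈pair (∈T-without-c p u≢p) (∈T-without-c r u≢r) (∈T-without-c n u≢n)

triVertices : Tri → List ℕ
triVertices (tri a b c) = a ∷ b ∷ c ∷ []

∈T⇒∈triVertices : ∀ {v} t → v ∈T t → v ∈ triVertices t
∈T⇒∈triVertices _ (inj₁ v≡a) = here v≡a
∈T⇒∈triVertices _ (inj₂ (inj₁ v≡b)) = there (here v≡b)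
∈T⇒∈triVertices _ (inj₂ (inj₂ v≡c)) = there (there (here v≡c))

EdgeT-sym : ∀ {t u v} → EdgeT t u v → EdgeT t v u
EdgeT-sym (u∈t , v∈t , u≢v) = v∈t , u∈t , u≢v ∘ sym

module Strip (G : Outerpath) where

  verticesBelow : ℕ → List ℕ
  verticesBelow zero = []
  verticesBelow (suc n) = triVertices (face G n) ++ verticesBelow n

  ∈verticesBelow : ∀ {n j v} → j < n → v ∈T face G j → v ∈ verticesBelow n
  ∈verticesBelow {suc n} {j} j<1+n v∈j with m≤n⇒m<n∨m≡n (≤-pred j<1+n)
  ... | inj₁ j<n = ∈-++⁺ʳ (triVertices (face G n)) (∈verticesBelow j<n v∈j)
  ... | inj₂ refl = ∈-++⁺ˡ (∈T⇒∈triVertices (face G j) v∈j)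

  graph : FiniteGraph (GEdge G)
  graph = record
    { vertices  = verticesBelow (h G)
    ; ∈vertices = λ { (_ , i<h , _ , v∈i , _) → ∈verticesBelow i<h v∈i }
    ; adjacent? = λ u v → anyUpTo? (λ i → EdgeT? (face G i) u v) (h G)
    ; symmetric = λ { (i , i<h , e) → i , i<h , EdgeT-sym e }
    }

  rangeGraph : ∀ {lo hi} → hi < h G → FiniteGraph (RangeEdge G lo hi)
  rangeGraph {lo} {hi} hi<h = record
    { vertices  = verticesBelow (h G)
    ; ∈vertices = λ { (_ , _ , i≤hi , _ , v∈i , _) →
                        ∈verticesBelow (≤-<-trans i≤hi hi<h) v∈i }
    ; adjacent? = RangeEdge?
    ; symmetric = λ { (i , lo≤i , i≤hi , e) → i , lo≤i , i≤hi , EdgeT-sym e }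
    }
    where
      RangeEdge? : ∀ u v → Dec (RangeEdge G lo hi u v)
      RangeEdge? u v with anyUpTo? (λ i → (lo ≤? i) ×-dec EdgeT? (face G i) u v) (suc hi)
      ... | yes (i , i<1+hi , lo≤i , e) = yes (i , lo≤i , ≤-pred i<1+hi , e)
      ... | no ¬e = no λ { (i , lo≤i , i≤hi , e) → ¬e (i , s≤s i≤hi , lo≤i , e) }

  range-vert⇒vert : ∀ {lo hi v} → hi < h G → Vert (RangeEdge G lo hi) v → Vert (GEdge G) v
  range-vert⇒vert hi<h (u , i , _ , i≤hi , e) = u , i , ≤-<-trans i≤hi hi<h , e

  -- The new vertex of face q+1 is none of p, r, z, so z is p or r.
  old-vertex-of-next-face : ∀ {q p r a z} → suc q < h G →
    EdgeT (face G q) p r → EdgeT (face G (suc q)) p r →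
    a ≤ q → z ∈T face G a → z ∈T face G (suc q) → z ≡ p ⊎ z ≡ r
  old-vertex-of-next-face {q} {p} {r} {a} {z} 1+q<h (p∈q , r∈q , p≢r) (p∈q+1 , r∈q+1 , _)
                          a≤q z∈a z∈q+1
    with newVert G q 1+q<h | z ≟ p | z ≟ r
  ... | _ | yes z≡p | _ = inj₁ z≡p
  ... | _ | no _ | yes z≡r = inj₂ z≡r
  ... | n , n∈q+1 , n-new | no z≢p | no z≢r =
    ⊥-elim (¬4-distinct-∈T z∈q+1 p∈q+1 r∈q+1 n∈q+1
              z≢p z≢r (old z∈a a≤q) p≢r (old p∈q ≤-refl) (old r∈q ≤-refl))
    where
      old : ∀ {v j} → v ∈T face G j → j ≤ q → v ≢ n
      old v∈j j≤q refl = n-new _ j≤q v∈j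

  ∈-previous-face : ∀ {j a z} → suc j < h G → a ≤ j →
                    z ∈T face G a → z ∈T face G (suc j) → z ∈T face G j
  ∈-previous-face {j} 1+j<h a≤j z∈a z∈j+1 with adjacent G j 1+j<h
  ... | p , r , pr∈j , pr∈j+1 with old-vertex-of-next-face 1+j<h pr∈j pr∈j+1 a≤j z∈a z∈j+1
  ...   | inj₁ refl = proj₁ pr∈j
  ...   | inj₂ refl = proj₁ (proj₂ pr∈j)

  ∈-between : ∀ {a m b z} → a ≤ m → m ≤ b → b < h G →
              z ∈T face G a → z ∈T face G b → z ∈T face G m
  ∈-between {b = zero} _ z≤n _ _ z∈b = z∈b
  ∈-between {a} {m} {suc b} a≤m m≤1+b 1+b<h z∈a z∈1+b with m≤n⇒m<n∨m≡n m≤1+b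
  ... | inj₂ refl = z∈1+b
  ... | inj₁ m<1+b = ∈-between a≤m m≤b (<-trans (n<1+n b) 1+b<h) z∈a
                       (∈-previous-face 1+b<h (≤-trans a≤m m≤b) z∈a z∈1+b)
    where m≤b = ≤-pred m<1+b

  apart-far : ∀ {a b u v} → suc (suc a) ≤ b → b < h G →
              EdgeT (face G a) u v → ¬ EdgeT (face G b) u v
  apart-far {a} {suc (suc c)} (s≤s (s≤s a≤c)) b<h (u∈a , v∈a , u≢v) uv∈b@(u∈b , v∈b , _) =
    apart G c b<h _ _ (between u∈a u∈b , between v∈a v∈b , u≢v) uv∈b
    where
      c≤b = ≤-trans (n≤1+n c) (n≤1+n (suc c))
      between : ∀ {z} → z ∈T face G a → z ∈T face G (suc (suc c)) → z ∈T face G c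
      between = ∈-between a≤c c≤b b<h

  shared-edge-next-face : ∀ {a b u v} → a < b → b < h G →
                          EdgeT (face G a) u v → EdgeT (face G b) u v → b ≡ suc a
  shared-edge-next-face a<b b<h uv∈a uv∈b with m≤n⇒m<n∨m≡n a<b
  ... | inj₂ 1+a≡b = sym 1+a≡b
  ... | inj₁ 1+a<b = ⊥-elim (apart-far 1+a<b b<h uv∈a uv∈b)

  Below Above : ℕ → ℕ → Set
  Below q v = ∃ λ j → j ≤ q × v ∈T face G j
  Above q v = ∃ λ j → q < j × j < h G × v ∈T face G j

  cut-separates : ∀ {q p w} → suc q < h G → EdgeT (face G q) p w → EdgeT (face G (suc q)) p w →
                  Separation (GEdge G) (λ z → z ≡ p ⊎ z ≡ w) (Below q) (Above q)
  cut-separates {q} {p} {w} 1+q<h pw∈q pw∈q+1 = record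
    { closed₀ = closed₀ ; closed₁ = closed₁ ; meet = meet }
    where
      meet : ∀ {z} → Below q z → Above q z → z ≡ p ⊎ z ≡ w
      meet (a , a≤q , z∈a) (b , q<b , b<h , z∈b) =
        old-vertex-of-next-face 1+q<h pw∈q pw∈q+1 a≤q z∈a
          (∈-between (≤-trans a≤q (n≤1+n q)) q<b b<h z∈a z∈b)
      closed₀ : ClosedOutside (GEdge G) _ (Below q)
      closed₀ below u∉B (j , j<h , u∈j , v∈j , _) with j ≤? q
      ... | yes j≤q = j , j≤q , v∈j
      ... | no j≰q = ⊥-elim (u∉B (meet below (j , ≰⇒> j≰q , j<h , u∈j)))
      closed₁ : ClosedOutside (GEdge G) _ (Above q)
      closed₁ above u∉B (j , j<h , u∈j , v∈j , _) with q <? j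
      ... | yes q<j = j , q<j , j<h , v∈j
      ... | no q≮j = ⊥-elim (u∉B (meet (j , ≮⇒≥ q≮j , u∈j) above))

  SharesOnly : ℕ → ℕ → ℕ → ℕ → ℕ → ℕ → Set
  SharesOnly lo₀ hi₀ lo₁ hi₁ p w =
    ∀ u v → RangeEdge G lo₀ hi₀ u v → RangeEdge G lo₁ hi₁ u v → SameEdge u v p w

  -- The edges ab and ac of a common face would both be pw.
  ¬common-face : ∀ {lo₀ hi₀ lo₁ hi₁ p w j} → j < h G → SharesOnly lo₀ hi₀ lo₁ hi₁ p w →
                 lo₀ ≤ j → j ≤ hi₀ → lo₁ ≤ j → j ≤ hi₁ → ⊥
  ¬common-face {j = j} j<h shared lo₀≤j j≤hi₀ lo₁≤j j≤hi₁ =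
    b≢c (SameEdge-cancelˡ (common ab) (common ac))
    where
      open Tri (face G j)
      a≢b×b≢c×a≢c = distinct G j j<h
      b≢c = proj₁ (proj₂ a≢b×b≢c×a≢c)
      ab : EdgeT (face G j) a b
      ab = inj₁ refl , inj₂ (inj₁ refl) , proj₁ a≢b×b≢c×a≢c
      ac : EdgeT (face G j) a c
      ac = inj₁ refl , inj₂ (inj₂ refl) , proj₂ (proj₂ a≢b×b≢c×a≢c)
      common : ∀ {u v} → EdgeT (face G j) u v → SameEdge u v _ _
      common e = shared _ _ (j , lo₀≤j , j≤hi₀ , e) (j , lo₁≤j , j≤hi₁ , e)

  ranges-apart : ∀ {lo₀ hi₀ lo₁ hi₁ p w} → lo₀ ≤ hi₀ → lo₁ ≤ hi₁ → hi₀ < h G →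
                 SharesOnly lo₀ hi₀ lo₁ hi₁ p w → hi₀ < lo₁ ⊎ hi₁ < lo₀
  ranges-apart {lo₀} {hi₀} {lo₁} {hi₁} lo₀≤hi₀ lo₁≤hi₁ hi₀<h shared
    with hi₀ <? lo₁ | hi₁ <? lo₀
  ... | yes hi₀<lo₁ | _ = inj₁ hi₀<lo₁
  ... | no _ | yes hi₁<lo₀ = inj₂ hi₁<lo₀
  ... | no hi₀≮lo₁ | no hi₁≮lo₀ with ≤-total lo₀ lo₁
  ...   | inj₁ lo₀≤lo₁ = ⊥-elim (¬common-face (≤-<-trans (≮⇒≥ hi₀≮lo₁) hi₀<h) shared
                                   lo₀≤lo₁ (≮⇒≥ hi₀≮lo₁) ≤-refl lo₁≤hi₁)
  ...   | inj₂ lo₁≤lo₀ = ⊥-elim (¬common-face (≤-<-trans lo₀≤hi₀ hi₀<h) shared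
                                   ≤-refl lo₀≤hi₀ lo₁≤lo₀ (≮⇒≥ hi₁≮lo₀))

  edge-of-apart-range-¬inner : ∀ {lo₀ hi₀ lo₁ hi₁ u v} → hi₀ < h G → hi₁ < h G →
    hi₀ < lo₁ ⊎ hi₁ < lo₀ → RangeEdge G lo₀ hi₀ u v → ¬ RangeInner G lo₁ hi₁ u v
  edge-of-apart-range-¬inner hi₀<h hi₁<h (inj₁ hi₀<lo₁)
    (j , _ , j≤hi₀ , uv∈j) (i , k , lo₁≤i , i<k , k≤hi₁ , _ , uv∈k) =
    apart-far (<-≤-trans (s≤s (≤-<-trans j≤hi₀ (<-≤-trans hi₀<lo₁ lo₁≤i))) i<k)
              (≤-<-trans k≤hi₁ hi₁<h) uv∈j uv∈k
  edge-of-apart-range-¬inner hi₀<h hi₁<h (inj₂ hi₁<lo₀)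
    (j , lo₀≤j , j≤hi₀ , uv∈j) (i , k , _ , i<k , k≤hi₁ , uv∈i , _) =
    apart-far (≤-trans (s≤s i<k) (≤-trans (s≤s k≤hi₁) (≤-trans hi₁<lo₀ lo₀≤j)))
              (≤-<-trans j≤hi₀ hi₀<h) uv∈i uv∈j

module ConsecutiveFans (G : Outerpath) (A : Rel) {s t : ℕ} (st : IsSTOuterpath G A s t) where
  open Strip G

  cut-between-ranges : ∀ {lo₀ hi₀ lo₁ hi₁ p w y₀ y₁} → hi₀ < lo₁ → hi₁ < h G →
    RangeEdge G lo₀ hi₀ p w → RangeEdge G lo₁ hi₁ p w →
    Vert (RangeEdge G lo₀ hi₀) y₀ → Vert (RangeEdge G lo₁ hi₁) y₁ →
    (∀ b → b ≡ p ⊎ b ≡ w → Path A b y₀) → (∀ b → b ≡ p ⊎ b ≡ w → Path A b y₁) → ⊥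
  cut-between-ranges {hi₀ = hi₀} {p = p} {w} {y₀} {y₁} hi₀<lo₁ hi₁<h
    (j₀ , _ , j₀≤hi₀ , pw∈j₀) (j₁ , lo₁≤j₁ , j₁≤hi₁ , pw∈j₁) y₀∈ y₁∈ cut⇝y₀ cut⇝y₁ =
    ¬cut-reaches-both-sides st (reaches-sink graph st) (λ z → (z ≟ p) ⊎-dec (z ≟ w))
      separation y₀-below y₁-above (range-vert⇒vert hi₀<h y₀∈) (range-vert⇒vert hi₁<h y₁∈)
      cut⇝y₀ cut⇝y₁
    where
      j₁<h = ≤-<-trans j₁≤hi₁ hi₁<h
      hi₀<j₁ = <-≤-trans hi₀<lo₁ lo₁≤j₁
      hi₀<h = <-trans hi₀<j₁ j₁<h
      j₁≡1+j₀ : j₁ ≡ suc j₀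
      j₁≡1+j₀ = shared-edge-next-face (≤-<-trans j₀≤hi₀ hi₀<j₁) j₁<h pw∈j₀ pw∈j₁
      separation = cut-separates (subst (_< h G) j₁≡1+j₀ j₁<h) pw∈j₀
                                 (subst (λ j → EdgeT (face G j) p w) j₁≡1+j₀ pw∈j₁)
      hi₀≤j₀ : hi₀ ≤ j₀
      hi₀≤j₀ = ≤-pred (≤-trans hi₀<j₁ (≤-reflexive j₁≡1+j₀))
      y₀-below : Below j₀ y₀
      y₀-below = let (_ , j , _ , j≤hi₀ , y₀∈j , _) = y₀∈ in j , ≤-trans j≤hi₀ hi₀≤j₀ , y₀∈j
      y₁-above : Above j₀ y₁
      y₁-above = let (_ , j , lo₁≤j , j≤hi₁ , y₁∈j , _) = y₁∈ in
        j , ≤-<-trans j₀≤hi₀ (<-≤-trans hi₀<lo₁ lo₁≤j) , ≤-<-trans j≤hi₁ hi₁<h , y₁∈j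

  shared-edge-ends-at-sink : ∀ {lo₀ hi₀ lo₁ hi₁ x₀ y₀ x₁ y₁ p w} → hi₀ < h G → hi₁ < h G →
    IsDAG (RangeEdge G lo₀ hi₀) (Restrict A (RangeEdge G lo₀ hi₀)) x₀ y₀ →
    IsDAG (RangeEdge G lo₁ hi₁) (Restrict A (RangeEdge G lo₁ hi₁)) x₁ y₁ →
    A p w → RangeEdge G lo₀ hi₀ p w → RangeEdge G lo₁ hi₁ p w → SharesOnly lo₀ hi₀ lo₁ hi₁ p w →
    ¬ OneSided G lo₁ hi₁ p y₁ → w ≡ y₀
  shared-edge-ends-at-sink {lo₀} {hi₀} {lo₁} {hi₁} {y₀ = y₀} {y₁ = y₁} {p} {w}
    hi₀<h hi₁<h D₀ D₁ p→w pw∈₀ pw∈₁ shared ¬one-sided with w ≟ y₀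
  ... | yes w≡y₀ = w≡y₀
  ... | no w≢y₀ = ⊥-elim (¬order order)
    where
      lo≤hi : ∀ {lo hi u v} → RangeEdge G lo hi u v → lo ≤ hi
      lo≤hi (_ , lo≤j , j≤hi , _) = ≤-trans lo≤j j≤hi
      order : hi₀ < lo₁ ⊎ hi₁ < lo₀
      order = ranges-apart (lo≤hi pw∈₀) (lo≤hi pw∈₁) hi₀<h shared
      w≢y₁ : w ≢ y₁
      w≢y₁ refl = ¬one-sided (pw∈₁ , edge-of-apart-range-¬inner hi₀<h hi₁<h order pw∈₀)
      cut⇝y₀ : ∀ b → b ≡ p ⊎ b ≡ w → Path A b y₀
      cut⇝y₀ b b∈cut =
        Path-restrict (arc-ends-reach-sink (rangeGraph hi₀<h) D₀ (p→w , pw∈₀) w≢y₀ b b∈cut)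
      cut⇝y₁ : ∀ b → b ≡ p ⊎ b ≡ w → Path A b y₁
      cut⇝y₁ b b∈cut =
        Path-restrict (arc-ends-reach-sink (rangeGraph hi₁<h) D₁ (p→w , pw∈₁) w≢y₁ b b∈cut)
      ¬order : ¬ (hi₀ < lo₁ ⊎ hi₁ < lo₀)
      ¬order (inj₁ hi₀<lo₁) = cut-between-ranges hi₀<lo₁ hi₁<h pw∈₀ pw∈₁
                                (IsDAG.y-vert D₀) (IsDAG.y-vert D₁) cut⇝y₀ cut⇝y₁
      ¬order (inj₂ hi₁<lo₀) = cut-between-ranges hi₁<lo₀ hi₀<h pw∈₁ pw∈₀
                                (IsDAG.y-vert D₁) (IsDAG.y-vert D₀) cut⇝y₁ cut⇝y₀

lemma5 : (G : Outerpath) (A : Rel) (s t : ℕ) →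
         IsSTOuterpath G A s t → Primary G s →
         (D : FanDecomp G A s) →
         ∀ i → suc i < FanDecomp.k D →
         ¬ OneSided G (FanDecomp.lo D (suc i)) (FanDecomp.hi D (suc i))
                      (FanDecomp.src D (suc i)) (FanDecomp.snk D (suc i)) →
         SameEdge (FanDecomp.eTl D i) (FanDecomp.eHd D i)
                  (FanDecomp.src D (suc i)) (FanDecomp.snk D i)
lemma5 G A s t st _ D i 1+i<k ¬one-sided =
  inj₁ (e-tail i 1+i<k ,
        shared-edge-ends-at-sink (proj₁ (proj₂ Fᵢ)) (proj₁ (proj₂ Fᵢ₊₁))
          (proj₁ (proj₂ (proj₂ Fᵢ))) (proj₁ (proj₂ (proj₂ Fᵢ₊₁)))
          (e-arc i 1+i<k) (proj₁ (e-in i 1+i<k)) (proj₂ (e-in i 1+i<k)) (e-only i 1+i<k)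
          ¬one-sided′)
  where
    open FanDecomp D
    open ConsecutiveFans G A st
    Fᵢ : IsFan G A (lo i) (hi i) (src i) (snk i)
    Fᵢ = fan i (<-trans (n<1+n i) 1+i<k)
    Fᵢ₊₁ : IsFan G A (lo (suc i)) (hi (suc i)) (src (suc i)) (snk (suc i))
    Fᵢ₊₁ = fan (suc i) 1+i<k
    ¬one-sided′ : ¬ OneSided G (lo (suc i)) (hi (suc i)) (eTl i) (snk (suc i))
    ¬one-sided′ rewrite e-tail i 1+i<k = ¬one-sided
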